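{- Let $X$ be an interval space. Then the following conditions are equivalent: (1) $X$ is interval-transitive. (2) For all $a,b,c\in X$, $[\{a\},[b,c]]\subseteq[[a,b],\{c\}]$. (3) For all $a,b,c\in X$, $[\{a\},[b,c]]=[[a,b],\{c\}]$. (4) The power set $P(X)$ with the binary operation $(A,C)\mapsto[A,C]$ is a semigroup. (5) The power set $P(X)$ with the binary operation $(A,C)\mapsto[A,C]$ is a commutative semigroup. (6) $X$ is interval-convex, and for each convex set $A\subseteq X$, the binary relation $\langle A,\cdot,\cdot\rangle$ on $X$ is transitive. (7) For all convex sets $A,B\subseteq X$, the set $[A,B]$ is convex. (8) For all $a,b,c\in X$, the set $[[a,b],\{c\}]$ is convex. (9) For all $a,b,c\in X$, $\mathrm{co}(\{a,b,c\})=[[a,b],\{c\}]$.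
   Context: An interval space is a set $X$ with a ternary relation $\langle\cdot,\cdot,\cdot\rangle$ such that: for each $a\in X$ the binary relations $\langle\cdot,\cdot,a\rangle$ and $\langle a,\cdot,\cdot\rangle$ are reflexive on $X$ (i.e. $\langle x,x,a\rangle$ and $\langle a,x,x\rangle$ for all $x$); for each $a\in X$ the binary relation $\langle\cdot,a,\cdot\rangle$ is symmetric (i.e. $\langle x,a,z\rangle\Rightarrow\langle z,a,x\rangle$); and $\langle x,y,x\rangle$ implies $y=x$. For $A\subseteq X$ and $b,c\in X$, $\langle A,b,c\rangle$ means there is $a\in A$ with $\langle a,b,c\rangle$. For $A,C\subseteq X$ and $b\in X$, $\langle A,b,C\rangle$ means there are $a\in A$, $c\in C$ with $\langle a,b,c\rangle$. For $a,c\in X$, $[a,c]=\{x\in X:\langle a,x,c\rangle\}$; for $A,C\subseteq X$, $[A,C]=\{x\in X:\langle A,x,C\rangle\}$. A set $C\subseteq X$ is convex iff $[C,C]\subseteq C$. For $A\subseteq X$, $\mathrm{co}(A)$ is the intersection of all convex supersets of $A$. $X$ is interval-transitive iff for all $a,b\in X$ the binary relation $\langle[a,b],\cdot,\cdot\rangle$ on $X$ is transitive. $X$ is interval-convex iff for all $a,b\in X$, $[a,b]$ is convex. -}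

module Defs where

open import Level using (Level; _⊔_; suc)
open import Data.Product using (Σ; ∃; _×_; _,_)
open import Data.Sum using (_⊎_)
open import Relation.Binary.PropositionalEquality using (_≡_)
open import Relation.Unary using (Pred; _⊆_; _≐_)
open import Algebra.Structures using (IsSemigroup; IsCommutativeSemigroup)

-- Subsets of X are predicates Pred X ℓ (at the same level as X and the relation),
-- so that P(X) is closed under the operation (A , C) ↦ [A , C].
record IsIntervalSpace {ℓ : Level} (X : Set ℓ) (R : X → X → X → Set ℓ) : Set ℓ where
  field
    refl-left  : ∀ a x → R x x a
    refl-right : ∀ a x → R a x x
    sym-mid    : ∀ a x z → R x a z → R z a x
    antisym    : ∀ x y → R x y x → y ≡ x

module Interval {ℓ : Level} {X : Set ℓ} (R : X → X → X → Set ℓ) where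

  ❴_❵ : X → Pred X ℓ
  ❴ a ❵ x = x ≡ a

  triple : X → X → X → Pred X ℓ
  triple a b c x = x ≡ a ⊎ (x ≡ b ⊎ x ≡ c)

  ⟨_,_,_⟩ₛ : Pred X ℓ → X → X → Set ℓ
  ⟨ A , b , c ⟩ₛ = ∃ λ a → A a × R a b c

  [_,_] : X → X → Pred X ℓ
  [ a , c ] x = R a x c

  ⟦_,_⟧ : Pred X ℓ → Pred X ℓ → Pred X ℓ
  ⟦ A , C ⟧ x = ∃ λ a → ∃ λ c → A a × C c × R a x c

  Convex : Pred X ℓ → Set ℓ
  Convex C = ⟦ C , C ⟧ ⊆ C

  co : Pred X ℓ → Pred X (suc ℓ)
  co A x = (C : Pred X ℓ) → Convex C → A ⊆ C → C x

  TransitiveRel : (X → X → Set ℓ) → Set ℓ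
  TransitiveRel S = ∀ {x y z} → S x y → S y z → S x z

  IntervalTransitive : Set ℓ
  IntervalTransitive = ∀ a b → TransitiveRel (λ x y → ⟨ [ a , b ] , x , y ⟩ₛ)

  IntervalConvex : Set ℓ
  IntervalConvex = ∀ a b → Convex [ a , b ]

  C1 C2 C3 C4 C5 C6 C7 C8 : Set (suc ℓ)
  C9 : Set (suc ℓ)
  C1 = Level.Lift (suc ℓ) IntervalTransitive
  C2 = Level.Lift (suc ℓ) (∀ a b c → ⟦ ❴ a ❵ , [ b , c ] ⟧ ⊆ ⟦ [ a , b ] , ❴ c ❵ ⟧)
  C3 = Level.Lift (suc ℓ) (∀ a b c → ⟦ ❴ a ❵ , [ b , c ] ⟧ ≐ ⟦ [ a , b ] , ❴ c ❵ ⟧)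
  C4 = IsSemigroup (_≐_ {A = X} {ℓ₁ = ℓ} {ℓ₂ = ℓ}) ⟦_,_⟧
  C5 = IsCommutativeSemigroup (_≐_ {A = X} {ℓ₁ = ℓ} {ℓ₂ = ℓ}) ⟦_,_⟧
  C6 = IntervalConvex × ((A : Pred X ℓ) → Convex A → TransitiveRel (λ x y → ⟨ A , x , y ⟩ₛ))
  C7 = (A B : Pred X ℓ) → Convex A → Convex B → Convex ⟦ A , B ⟧
  C8 = Level.Lift (suc ℓ) (∀ a b c → Convex ⟦ [ a , b ] , ❴ c ❵ ⟧)
  C9 = ∀ a b c → co (triple a b c) ≐ ⟦ [ a , b ] , ❴ c ❵ ⟧

module Submission where

-- Everything is organised around condition (2), which we call the exchange law:
--   x ∈ [a , y] and y ∈ [b , c]  imply  x ∈ [p , c] for some p ∈ [a , b].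
-- By the symmetry of ⟨_,·,_⟩ the exchange law also runs backwards, and from
-- the two directions we derive, in order:
--   * every interval [a , b] is convex;
--   * (A , C) ↦ [A , C] is associative (it is always commutative and monotone);
--   * ⟨A,·,·⟩ is transitive for every convex A, in particular for A = [a , b];
--   * [A , B] is convex whenever A and B are, by a chain of associativity steps;
--   * co {a , b , c} = [[a , b] , {c}], since the right side is a convex
--     superset of {a , b , c} contained in every such superset.
-- Conversely each of (1), (4), (6), (7), (8), (9) gives back the exchange law by
-- specialising to singletons, intervals or triangles [[a , b] , {c}].
-- The theorem then follows by routing every equivalence (1) ⇔ (i) through (2).

open import Defs
open import Level using (Level; lift; lower)
open import Data.Product using (Σ; _×_; _,_; proj₁; proj₂)
open import Data.Sum using (inj₁; inj₂)
open import Function.Base using (id; _∘_)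
open import Function.Bundles using (_⇔_; mk⇔)
open import Relation.Binary.PropositionalEquality using (refl)
open import Relation.Unary using (Pred; _⊆_; _≐_)
open import Relation.Unary.Properties using (≐-refl; ≐-sym)
open import Relation.Unary.Relation.Binary.Equality using (≐-isEquivalence)
open import Relation.Unary.Relation.Binary.Subset using (⊆-preorder)
open import Algebra.Structures using (IsSemigroup; IsCommutativeSemigroup)

module IntervalSpaceTheory {ℓ : Level} (X : Set ℓ) (R : X → X → X → Set ℓ)
                           (isIntervalSpace : IsIntervalSpace X R) where
  open IsIntervalSpace isIntervalSpace
  open Interval R
  open import Relation.Binary.Reasoning.Preorder (⊆-preorder X ℓ)

  ⟦⟧-mono : ∀ {A A′ B B′ : Pred X ℓ} → A ⊆ A′ → B ⊆ B′ → ⟦ A , B ⟧ ⊆ ⟦ A′ , B′ ⟧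
  ⟦⟧-mono A⊆A′ B⊆B′ (a , b , a∈A , b∈B , r) = a , b , A⊆A′ a∈A , B⊆B′ b∈B , r

  ⟦⟧-cong : ∀ {A A′ B B′ : Pred X ℓ} → A ≐ A′ → B ≐ B′ → ⟦ A , B ⟧ ≐ ⟦ A′ , B′ ⟧
  ⟦⟧-cong (A⊆A′ , A′⊆A) (B⊆B′ , B′⊆B) = ⟦⟧-mono A⊆A′ B⊆B′ , ⟦⟧-mono A′⊆A B′⊆B

  ⟦⟧-comm : ∀ {A B : Pred X ℓ} → ⟦ A , B ⟧ ⊆ ⟦ B , A ⟧
  ⟦⟧-comm {x = x} (a , b , a∈A , b∈B , r) = b , a , b∈B , a∈A , sym-mid x a b r

  convex-resp-≐ : ∀ {A B : Pred X ℓ} → A ≐ B → Convex A → Convex B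
  convex-resp-≐ (A⊆B , B⊆A) convexA = A⊆B ∘ convexA ∘ ⟦⟧-mono B⊆A B⊆A

  singleton-convex : ∀ a → Convex ❴ a ❵
  singleton-convex a (_ , _ , refl , refl , r) = antisym a _ r

  interval≐join : ∀ a b → [ a , b ] ≐ ⟦ ❴ a ❵ , ❴ b ❵ ⟧
  interval≐join a b = (λ r → a , b , refl , refl , r) , λ { (_ , _ , refl , refl , r) → r }

  vertices⊆triangle : ∀ a b c → triple a b c ⊆ ⟦ [ a , b ] , ❴ c ❵ ⟧
  vertices⊆triangle a b c (inj₁ refl)        = a , c , refl-left b a , refl , refl-left c a
  vertices⊆triangle a b c (inj₂ (inj₁ refl)) = b , c , refl-right a b , refl , refl-left c b
  vertices⊆triangle a b c (inj₂ (inj₂ refl)) = a , c , refl-left b a , refl , refl-right a c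

  triangle⊆hull : ∀ a b c → ⟦ [ a , b ] , ❴ c ❵ ⟧ ⊆ co (triple a b c)
  triangle⊆hull a b c (p , _ , p∈ab , refl , r) C convexC vertices⊆C =
    convexC (p , c , convexC (a , b , vertices⊆C (inj₁ refl) , vertices⊆C (inj₂ (inj₁ refl)) , p∈ab)
                   , vertices⊆C (inj₂ (inj₂ refl)) , r)

  -- A set equal to a convex hull is convex (the hull is the intersection of
  -- convex sets, hence convex itself).
  hull-convex : ∀ (A D : Pred X ℓ) → co A ≐ D → Convex D
  hull-convex A D (co⊆D , D⊆co) (u , v , u∈D , v∈D , r) =
    co⊆D λ C convexC A⊆C → convexC (u , v , D⊆co u∈D C convexC A⊆C , D⊆co v∈D C convexC A⊆C , r)

  Exchange : Set ℓ
  Exchange = ∀ a b c → ⟦ ❴ a ❵ , [ b , c ] ⟧ ⊆ ⟦ [ a , b ] , ❴ c ❵ ⟧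

  module _ (exch : Exchange) where

    exchange : ∀ {a b c x y} → R a x y → R b y c → Σ X λ p → R a p b × R p x c
    exchange {a} {b} {c} r₁ r₂ with exch a b c (a , _ , refl , r₂ , r₁)
    ... | p , _ , p∈ab , refl , r = p , p∈ab , r

    -- Backward form: p ∈ [a , b], x ∈ [p , c] give y ∈ [b , c] with x ∈ [a , y];
    -- it is the forward form applied to the mirrored configuration.
    exchange⁻ : ∀ {a b c x p} → R a p b → R p x c → Σ X λ y → R a x y × R b y c
    exchange⁻ {a} {b} {c} {x} {p} r₁ r₂ with exchange (sym-mid x p c r₂) (sym-mid p a b r₁)
    ... | y , r₃ , r₄ = y , sym-mid x y a r₄ , sym-mid y c b r₃

    -- (2) ⇒ interval-convexity: for p, q ∈ [a , b] and s ∈ [p , q], exchanging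
    -- twice and collapsing degenerate intervals [b , b], [a , a] gives s ∈ [a , b].
    interval-convex : IntervalConvex
    interval-convex a b (p , q , p∈ab , q∈ab , s∈pq) with exchange⁻ p∈ab s∈pq
    ... | y , s∈ay , y∈bq with exchange y∈bq (sym-mid q a b q∈ab)
    ... | t , t∈bb , y∈ta with antisym b t t∈bb
    ... | refl with exchange s∈ay (sym-mid y b a y∈ta)
    ... | u , u∈aa , s∈ub with antisym a u u∈aa
    ... | refl = s∈ub

    -- (2) ⇒ associativity of [_,_], one inclusion from each form of the law.
    assocˡ : ∀ {A B C : Pred X ℓ} → ⟦ A , ⟦ B , C ⟧ ⟧ ⊆ ⟦ ⟦ A , B ⟧ , C ⟧
    assocˡ (a , _ , a∈A , (b , c , b∈B , c∈C , y∈bc) , x∈ay) with exchange x∈ay y∈bc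
    ... | p , p∈ab , x∈pc = p , c , (a , b , a∈A , b∈B , p∈ab) , c∈C , x∈pc

    assocʳ : ∀ {A B C : Pred X ℓ} → ⟦ ⟦ A , B ⟧ , C ⟧ ⊆ ⟦ A , ⟦ B , C ⟧ ⟧
    assocʳ (_ , c , (a , b , a∈A , b∈B , p∈ab) , c∈C , x∈pc) with exchange⁻ p∈ab x∈pc
    ... | y , x∈ay , y∈bc = a , y , a∈A , (b , c , b∈B , c∈C , y∈bc) , x∈ay

    commutativeSemigroup : IsCommutativeSemigroup (_≐_ {A = X} {ℓ₁ = ℓ} {ℓ₂ = ℓ}) ⟦_,_⟧
    commutativeSemigroup = record
      { isSemigroup = record
        { isMagma = record { isEquivalence = ≐-isEquivalence ; ∙-cong = ⟦⟧-cong }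
        ; assoc   = λ _ _ _ → assocʳ , assocˡ }
      ; comm = λ _ _ → ⟦⟧-comm , ⟦⟧-comm }

    -- (2) ⇒ (3): the backward law gives the reverse inclusion.
    exchange-≐ : ∀ a b c → ⟦ ❴ a ❵ , [ b , c ] ⟧ ≐ ⟦ [ a , b ] , ❴ c ❵ ⟧
    exchange-≐ a b c = exch a b c , λ { (_ , _ , p∈ab , refl , x∈pc) →
      let (y , x∈ay , y∈bc) = exchange⁻ p∈ab x∈pc in a , y , refl , y∈bc , x∈ay }

    -- (2) ⇒ transitivity of ⟨A,·,·⟩ for every convex A: the point p ∈ [a , a′]
    -- produced by the exchange law stays in A.
    convex-transitive : ∀ (A : Pred X ℓ) → Convex A → TransitiveRel (λ x y → ⟨ A , x , y ⟩ₛ)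
    convex-transitive A convexA (a , a∈A , x∈ay) (a′ , a′∈A , y∈a′z) with exchange x∈ay y∈a′z
    ... | p , p∈aa′ , x∈pz = p , convexA (a , a′ , a∈A , a′∈A , p∈aa′) , x∈pz

    convex-join : ∀ (A B : Pred X ℓ) → Convex A → Convex B → Convex ⟦ A , B ⟧
    convex-join A B convexA convexB = begin
      ⟦ ⟦ A , B ⟧ , ⟦ A , B ⟧ ⟧   ∼⟨ assocˡ ⟩
      ⟦ ⟦ ⟦ A , B ⟧ , A ⟧ , B ⟧   ∼⟨ ⟦⟧-mono (⟦⟧-comm {⟦ A , B ⟧} {A}) id ⟩
      ⟦ ⟦ A , ⟦ A , B ⟧ ⟧ , B ⟧   ∼⟨ ⟦⟧-mono assocˡ id ⟩
      ⟦ ⟦ ⟦ A , A ⟧ , B ⟧ , B ⟧   ∼⟨ ⟦⟧-mono (⟦⟧-mono convexA id) id ⟩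
      ⟦ ⟦ A , B ⟧ , B ⟧           ∼⟨ assocʳ ⟩
      ⟦ A , ⟦ B , B ⟧ ⟧           ∼⟨ ⟦⟧-mono id convexB ⟩
      ⟦ A , B ⟧                   ∎

    -- (2) ⇒ (9): the triangle is a convex superset of the vertices below every
    -- other one.
    hull-formula : ∀ a b c → co (triple a b c) ≐ ⟦ [ a , b ] , ❴ c ❵ ⟧
    hull-formula a b c = (λ x∈co → x∈co _ triangle-convex (vertices⊆triangle a b c))
                       , triangle⊆hull a b c
      where
      triangle-convex : Convex ⟦ [ a , b ] , ❴ c ❵ ⟧
      triangle-convex = convex-join _ _ (interval-convex a b) (singleton-convex c)

  -- (1) ⇒ (2): for x ∈ [a , y], y ∈ [b , c] we have ⟨a,x,y⟩ and ⟨b,y,c⟩ with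
  -- a, b ∈ [a , b]; transitivity gives a point of [a , b] between x and c.
  transitive⇒exchange : IntervalTransitive → Exchange
  transitive⇒exchange trans a b c (_ , _ , refl , y∈bc , x∈ay)
    with trans a b (a , refl-left b a , x∈ay) (b , refl-right a b , y∈bc)
  ... | p , p∈ab , x∈pc = p , c , p∈ab , refl , x∈pc

  exchange⇒transitive : Exchange → IntervalTransitive
  exchange⇒transitive exch a b = convex-transitive exch [ a , b ] (interval-convex exch a b)

  convex-transitive⇒exchange : IntervalConvex × (∀ (A : Pred X ℓ) → Convex A
                                                  → TransitiveRel (λ x y → ⟨ A , x , y ⟩ₛ))
                             → Exchange
  convex-transitive⇒exchange (intervalConvex , transitive) =
    transitive⇒exchange (λ a b → transitive [ a , b ] (intervalConvex a b))

  associative⇒exchange : IsSemigroup (_≐_ {A = X} {ℓ₁ = ℓ} {ℓ₂ = ℓ}) ⟦_,_⟧ → Exchange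
  associative⇒exchange semigroup a b c (_ , _ , refl , y∈bc , x∈ay)
    with proj₂ (IsSemigroup.assoc semigroup ❴ a ❵ ❴ b ❵ ❴ c ❵)
               (a , _ , refl , (b , c , refl , refl , y∈bc) , x∈ay)
  ... | _ , _ , (_ , _ , refl , refl , p∈ab) , refl , x∈pc = _ , c , p∈ab , refl , x∈pc

  -- (7) ⇒ (8): [[a , b] , {c}] = [[{a} , {b}] , {c}] is built from singletons.
  convex-join⇒triangle-convex : (∀ (A B : Pred X ℓ) → Convex A → Convex B → Convex ⟦ A , B ⟧)
                              → ∀ a b c → Convex ⟦ [ a , b ] , ❴ c ❵ ⟧
  convex-join⇒triangle-convex join a b c =
    convex-resp-≐ (⟦⟧-cong (≐-sym (interval≐join a b)) ≐-refl)
      (join _ _ (join _ _ (singleton-convex a) (singleton-convex b)) (singleton-convex c))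

  hull-formula⇒triangle-convex : (∀ a b c → co (triple a b c) ≐ ⟦ [ a , b ] , ❴ c ❵ ⟧)
                               → ∀ a b c → Convex ⟦ [ a , b ] , ❴ c ❵ ⟧
  hull-formula⇒triangle-convex hull a b c = hull-convex (triple a b c) _ (hull a b c)

  -- (8) ⇒ (2): the triangle [[a , b] , {c}] contains a and y ∈ [b , c], hence
  -- every x ∈ [a , y].
  triangle-convex⇒exchange : (∀ a b c → Convex ⟦ [ a , b ] , ❴ c ❵ ⟧) → Exchange
  triangle-convex⇒exchange convex a b c (_ , y , refl , y∈bc , x∈ay) =
    convex a b c (a , y , (a , c , refl-left b a , refl , refl-left c a)
                        , (b , c , refl-right a b , refl , y∈bc) , x∈ay)

  ⇔-via-exchange : ∀ {P : Set (Level.suc ℓ)} → (Exchange → P) → (P → Exchange) → C1 ⇔ P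
  ⇔-via-exchange to from =
    mk⇔ (to ∘ transitive⇒exchange ∘ lower) (lift ∘ exchange⇒transitive ∘ from)

theorem2p3 : {ℓ : Level} (X : Set ℓ) (R : X → X → X → Set ℓ) → IsIntervalSpace X R →
    let open Interval R in
    (C1 ⇔ C2) × (C1 ⇔ C3) × (C1 ⇔ C4) × (C1 ⇔ C5) × (C1 ⇔ C6) × (C1 ⇔ C7) × (C1 ⇔ C8) × (C1 ⇔ C9)
theorem2p3 X R isIntervalSpace =
    via lift lower
  , via (lift ∘ exchange-≐) (λ c a b d → proj₁ (lower c a b d))
  , via (IsCommutativeSemigroup.isSemigroup ∘ commutativeSemigroup) associative⇒exchange
  , via commutativeSemigroup (associative⇒exchange ∘ IsCommutativeSemigroup.isSemigroup)
  , via (λ exch → interval-convex exch , convex-transitive exch) convex-transitive⇒exchange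
  , via convex-join (triangle-convex⇒exchange ∘ convex-join⇒triangle-convex)
  , via (lift ∘ convex-join⇒triangle-convex ∘ convex-join) (triangle-convex⇒exchange ∘ lower)
  , via hull-formula (triangle-convex⇒exchange ∘ hull-formula⇒triangle-convex)
  where open IntervalSpaceTheory X R isIntervalSpace renaming (⇔-via-exchange to via)
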